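{- Let $b>1$ be an odd integer. The only infinite smooth word $w$ over $\{1,b\}$ that is an infinite Lyndon word and such that $\Phi(w)$ starts with $1b$ is $m_{\{1<b\}}$.
   Context: Words are compared lexicographically with $1<b$. For a word $w$ over $\{1,b\}$ written as maximal blocks $\alpha_0^{i_0}\alpha_1^{i_1}\cdots$ ($\alpha_{k+1}\ne\alpha_k$, $i_k\ge1$), $\Delta(w)=i_0i_1\cdots$. An infinite word $w\in\{1,b\}^\omega$ is smooth if $\Delta^k(w)\in\{1,b\}^\omega$ for all $k\ge0$. $\Phi(w)=\Delta^0(w)[0]\,\Delta^1(w)[0]\,\Delta^2(w)[0]\cdots$. $m_{\{1<b\}}$ is the lexicographically minimal infinite smooth word over $\{1,b\}$. An infinite Lyndon word is an infinite word strictly smaller than each of its proper suffixes. -}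

module Defs where

open import Data.Nat using (ℕ; zero; suc; _+_; _<_; _≤_)
open import Data.Product using (Σ; _×_; _,_; proj₁)
open import Data.Sum using (_⊎_)
open import Relation.Binary.PropositionalEquality using (_≡_; _≢_)
open import Relation.Nullary using (¬_)

Word : Set
Word = ℕ → ℕ

_≈w_ : Word → Word → Set
u ≈w v = ∀ n → u n ≡ v n

Over : ℕ → Word → Set
Over b w = ∀ n → (w n ≡ 1) ⊎ (w n ≡ b)

-- strict lexicographic order (letters compared as naturals, so 1 < b when b > 1)
_<lex_ : Word → Word → Set
u <lex v = Σ ℕ λ n → (∀ i → i < n → u i ≡ v i) × (u n < v n)

suffix : ℕ → Word → Word
suffix k w i = w (k + i)

InfLyndon : Word → Set
InfLyndon w = ∀ k → 1 ≤ k → w <lex suffix k w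

blockStart : Word → ℕ → ℕ
blockStart v zero = 0
blockStart v (suc n) = blockStart v n + v n

-- IsDelta w v : v is the (infinite) run-length sequence Δ(w) of w, i.e.
-- w = α₀^{v 0} α₁^{v 1} ⋯ with maximal blocks (α_{k+1} ≠ α_k, v k ≥ 1).
IsDelta : Word → Word → Set
IsDelta w v =
  (∀ n → 1 ≤ v n) ×
  (∀ n i → i < v n → w (blockStart v n + i) ≡ w (blockStart v n)) ×
  (∀ n → w (blockStart v (suc n)) ≢ w (blockStart v n))

-- Smooth b w : a witness that Δ^k(w) is an infinite word over {1,b} for all k.
-- The witness is the sequence W k = Δ^k(w) (unique when it exists).
Smooth : ℕ → Word → Set
Smooth b w = Σ (ℕ → Word) λ W →
  (W 0 ≈w w) × (∀ k → Over b (W k)) × (∀ k → IsDelta (W k) (W (suc k)))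

Φ : ∀ {b w} → Smooth b w → Word
Φ s k = proj₁ s k 0

IsMinSmooth : ℕ → Word → Set
IsMinSmooth b m = Smooth b m × (∀ w → Smooth b w → ¬ (w <lex m))

-- For odd b every run of a word over {1, b} has odd length, so the j-th run starts at a position of
-- the parity of j and repeats the first letter or the other one according to that parity. Hence a
-- lexicographic comparison can be read off the first differing run one or two Δ-levels down. With
-- this, the minimal smooth word m starts with 1, Δ(m) with b, and Δ²(m) is again minimal, so
-- Φ(m) = (1b)^ω; and m is Lyndon by induction on the position of a suffix, comparing two levels down.
-- Conversely, if w is Lyndon and Φ(w) starts with 1b, the same comparisons show that Δ²(w) has no
-- smaller suffix and Φ continues with 1b, so Φ(w) = (1b)^ω as well. Finally Φ = (1b)^ω determines a
-- smooth word, since every odd level starts with a run of length b ≥ 2, so each level fixes a longer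
-- prefix of the level above it.

module Submission where

open import Defs
open import Data.Nat using (ℕ; zero; suc; _+_; _∸_; _<_; _≤_; z≤n; s≤s; _<?_; parity)
open import Data.Nat.Properties
open import Data.Nat.Divisibility using (_∣_; divides)
open import Data.Parity.Base using (Parity; 0ℙ; 1ℙ; _⁻¹)
import Data.Parity.Base as ℙ
import Data.Parity.Properties as ℙ
open import Data.Product using (Σ; _×_; _,_; proj₁; proj₂)
open import Data.Sum using (_⊎_; inj₁; inj₂)
open import Data.Empty using (⊥; ⊥-elim)
open import Relation.Binary.PropositionalEquality
open import Relation.Nullary using (¬_; yes; no)
open import Relation.Binary using (tri<; tri≈; tri>)
open import Data.Nat.Induction using (<-rec)

parity-suc : ∀ n → parity (suc n) ≡ parity n ⁻¹
parity-suc n = sym (ℙ.⁻¹-selfInverse (ℙ.suc-homo-⁻¹ n))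

parity≡0ℙ⇒2∣ : ∀ n → parity n ≡ 0ℙ → 2 ∣ n
parity≡0ℙ⇒2∣ zero _ = divides 0 refl
parity≡0ℙ⇒2∣ (suc (suc n)) e with parity≡0ℙ⇒2∣ n e
... | divides q n≡q*2 = divides (suc q) (cong (λ m → suc (suc m)) n≡q*2)

¬2∣⇒parity≡1ℙ : ∀ n → ¬ (2 ∣ n) → parity n ≡ 1ℙ
¬2∣⇒parity≡1ℙ n 2∤n with parity n in e
... | 1ℙ = refl
... | 0ℙ = ⊥-elim (2∤n (parity≡0ℙ⇒2∣ n e))

_◂_ : ∀ {A : Set} → A → (ℕ → A) → ℕ → A
(a ◂ u) zero = a
(a ◂ u) (suc i) = u i

_≈[_]_ : Word → ℕ → Word → Set
u ≈[ n ] v = ∀ i → i < n → u i ≡ v i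

≈[]-sym : ∀ {u v n} → u ≈[ n ] v → v ≈[ n ] u
≈[]-sym u≈v i i<n = sym (u≈v i i<n)

<lex-asym : ∀ {u v} → u <lex v → ¬ (v <lex u)
<lex-asym (n , u≡v , u<v) (n' , v≡u , v<u) with <-cmp n n'
... | tri< n<n' _ _ = <-irrefl (sym (v≡u n n<n')) u<v
... | tri≈ _ refl _ = <-asym u<v v<u
... | tri> _ _ n'<n = <-irrefl (sym (u≡v n' n'<n)) v<u

<lex-resp-≈ : ∀ {u u' v v'} → u ≈w u' → v ≈w v' → u <lex v → u' <lex v'
<lex-resp-≈ u≈u' v≈v' (n , agree , lt) =
  n , (λ i i<n → trans (sym (u≈u' i)) (trans (agree i i<n) (v≈v' i))) , subst₂ _<_ (u≈u' n) (v≈v' n) lt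

NoSmallerSuffix : Word → Set
NoSmallerSuffix x = ∀ P → 1 ≤ P → ¬ (suffix P x <lex x)

lyndon⇒noSmallerSuffix : ∀ {x x'} → x ≈w x' → InfLyndon x' → NoSmallerSuffix x
lyndon⇒noSmallerSuffix x≈x' lyndon P 1≤P smaller =
  <lex-asym (lyndon P 1≤P) (<lex-resp-≈ (λ i → x≈x' (P + i)) x≈x' smaller)

Positive : Word → Set
Positive u = ∀ n → 1 ≤ u n

blockStart-cong : ∀ {u u'} → u ≈w u' → ∀ j → blockStart u j ≡ blockStart u' j
blockStart-cong u≈u' zero = refl
blockStart-cong u≈u' (suc j) = cong₂ _+_ (blockStart-cong u≈u' j) (u≈u' j)

blockStart-agree : ∀ {u u'} j → u ≈[ j ] u' → blockStart u j ≡ blockStart u' j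
blockStart-agree zero agree = refl
blockStart-agree (suc j) agree =
  cong₂ _+_ (blockStart-agree j (λ i i<j → agree i (m<n⇒m<1+n i<j))) (agree j ≤-refl)

blockStart-mono : ∀ u {j k} → j ≤ k → blockStart u j ≤ blockStart u k
blockStart-mono u {j} j≤k with m≤n⇒∃[o]m+o≡n j≤k
... | o , refl = go o
  where
  go : ∀ o → blockStart u j ≤ blockStart u (j + o)
  go zero rewrite +-identityʳ j = ≤-refl
  go (suc o) rewrite +-suc j o = ≤-trans (go o) (m≤m+n _ _)

n+u₀≤blockStart : ∀ {u} → Positive u → ∀ n → n + u 0 ≤ blockStart u (suc n)
n+u₀≤blockStart pos zero = ≤-refl
n+u₀≤blockStart {u} pos (suc n) =
  ≤-trans (≤-reflexive (+-comm 1 (n + u 0))) (+-mono-≤ (n+u₀≤blockStart pos n) (pos (suc n)))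

n≤blockStart : ∀ {u} → Positive u → ∀ n → n ≤ blockStart u n
n≤blockStart pos zero = z≤n
n≤blockStart pos (suc n) =
  ≤-trans (≤-reflexive (+-comm 1 n)) (≤-trans (+-monoʳ-≤ n (pos 0)) (n+u₀≤blockStart pos n))

j<blockStart : ∀ {u} → Positive u → 2 ≤ u 0 → ∀ j → 1 ≤ j → j < blockStart u j
j<blockStart pos 2≤u₀ (suc j) _ =
  ≤-trans (≤-reflexive (+-comm 2 j)) (≤-trans (+-monoʳ-≤ j 2≤u₀) (n+u₀≤blockStart pos j))

InBlock : Word → ℕ → Set
InBlock u n = Σ ℕ λ j → Σ ℕ λ t → t < u j × blockStart u j + t ≡ n

locate : ∀ {u} → Positive u → ∀ n → InBlock u n
locate pos zero = 0 , 0 , pos 0 , refl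
locate {u} pos (suc n) with locate pos n
... | j , t , t<uj , refl with suc t <? u j
...   | yes t+1<uj = j , suc t , t+1<uj , +-suc (blockStart u j) t
...   | no t+1≮uj = suc j , 0 , pos (suc j) ,
          trans (+-identityʳ _) (trans (cong (blockStart u j +_) (sym t+1≡uj)) (+-suc (blockStart u j) t))
  where
  t+1≡uj : suc t ≡ u j
  t+1≡uj = ≤-antisym t<uj (≮⇒≥ t+1≮uj)

inBlock-<-inBlock : ∀ u {j j' t t'} → t < u j → j < j' → blockStart u j + t < blockStart u j' + t'
inBlock-<-inBlock u {j} {j'} {t} {t'} t<uj j<j' =
  <-≤-trans (+-monoʳ-< (blockStart u j) t<uj) (≤-trans (blockStart-mono u j<j') (m≤m+n _ t'))

inBlock-index-unique : ∀ u {j j' t t'} → t < u j → t' < u j' →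
                       blockStart u j + t ≡ blockStart u j' + t' → j ≡ j'
inBlock-index-unique u {j} {j'} t<uj t'<uj' eq with <-cmp j j'
... | tri< j<j' _ _ = ⊥-elim (<-irrefl eq (inBlock-<-inBlock u t<uj j<j'))
... | tri≈ _ j≡j' _ = j≡j'
... | tri> _ _ j'<j = ⊥-elim (<-irrefl (sym eq) (inBlock-<-inBlock u t'<uj' j'<j))

IsDelta-respʳ-≈ : ∀ {x u u'} → u ≈w u' → IsDelta x u → IsDelta x u'
IsDelta-respʳ-≈ {x} u≈u' (pos , const , change) =
  (λ n → subst (1 ≤_) (u≈u' n) (pos n)) ,
  (λ n i i<u'n → subst (λ p → x (p + i) ≡ x p) (blockStart-cong u≈u' n)
                        (const n i (subst (i <_) (sym (u≈u' n)) i<u'n))) ,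
  (λ n → subst₂ (λ p q → x p ≢ x q) (blockStart-cong u≈u' (suc n)) (blockStart-cong u≈u' n) (change n))

Δ-suffix : ∀ {x u} → IsDelta x u → ∀ j t → t < u j →
           IsDelta (suffix (blockStart u j + t) x) ((u j ∸ t) ◂ suffix (suc j) u)
Δ-suffix {x} {u} (pos , const , change) j t t<uj = pos' , const' , change'
  where
  p : ℕ
  p = blockStart u j + t
  u' : Word
  u' = (u j ∸ t) ◂ suffix (suc j) u
  starts : ∀ i → p + blockStart u' (suc i) ≡ blockStart u (suc (j + i))
  starts zero = begin
    blockStart u j + t + (u j ∸ t)   ≡⟨ +-assoc (blockStart u j) t (u j ∸ t) ⟩
    blockStart u j + (t + (u j ∸ t)) ≡⟨ cong (blockStart u j +_) (m+[n∸m]≡n (<⇒≤ t<uj)) ⟩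
    blockStart u (suc j)             ≡⟨ cong (λ k → blockStart u (suc k)) (sym (+-identityʳ j)) ⟩
    blockStart u (suc (j + 0))       ∎
    where open ≡-Reasoning
  starts (suc i) = begin
    p + (blockStart u' (suc i) + u (suc (j + i)))   ≡⟨ sym (+-assoc p _ _) ⟩
    p + blockStart u' (suc i) + u (suc (j + i))     ≡⟨ cong (_+ u (suc (j + i))) (starts i) ⟩
    blockStart u (suc (suc (j + i)))               ≡⟨ cong (λ k → blockStart u (suc k)) (sym (+-suc j i)) ⟩
    blockStart u (suc (j + suc i))                 ∎
    where open ≡-Reasoning
  x-first-block : ∀ i → t + i < u j → x (p + i) ≡ x (blockStart u j)
  x-first-block i lt = trans (cong x (+-assoc (blockStart u j) t i)) (const j (t + i) lt)
  pos' : Positive u'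
  pos' zero = m<n⇒0<n∸m t<uj
  pos' (suc n) = pos (suc (j + n))
  const' : ∀ n i → i < u' n → x (p + (blockStart u' n + i)) ≡ x (p + blockStart u' n)
  const' zero i i<u'0 =
    trans (x-first-block i (subst (t + i <_) (m+[n∸m]≡n (<⇒≤ t<uj)) (+-monoʳ-< t i<u'0)))
          (sym (x-first-block 0 (subst (_< u j) (sym (+-identityʳ t)) t<uj)))
  const' (suc n) i i<u'n =
    trans (cong x (trans (sym (+-assoc p _ i)) (cong (_+ i) (starts n))))
          (trans (const (suc (j + n)) i i<u'n) (cong x (sym (starts n))))
  change' : ∀ n → x (p + blockStart u' (suc n)) ≢ x (p + blockStart u' n)
  change' zero eq = change j (begin
    x (blockStart u (suc j))       ≡⟨ cong (λ k → x (blockStart u (suc k))) (sym (+-identityʳ j)) ⟩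
    x (blockStart u (suc (j + 0))) ≡⟨ cong x (sym (starts 0)) ⟩
    x (p + blockStart u' 1)        ≡⟨ eq ⟩
    x (p + 0)                      ≡⟨ x-first-block 0 (subst (_< u j) (sym (+-identityʳ t)) t<uj) ⟩
    x (blockStart u j)             ∎)
    where open ≡-Reasoning
  change' (suc n) eq = change (suc (j + n))
    (trans (cong x (trans (cong (λ k → blockStart u (suc k)) (sym (+-suc j n))) (sym (starts (suc n)))))
           (trans eq (cong x (starts n))))

Δ-suffix-blockStart : ∀ {x u} → IsDelta x u → ∀ j → IsDelta (suffix (blockStart u j) x) (suffix j u)
Δ-suffix-blockStart {x} {u} D j =
  subst (λ p → IsDelta (suffix p x) (suffix j u)) (+-identityʳ (blockStart u j))
        (IsDelta-respʳ-≈ {suffix (blockStart u j + 0) x} u'≈ (Δ-suffix {x} {u} D j 0 (proj₁ D j)))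
  where
  u'≈ : ((u j ∸ 0) ◂ suffix (suc j) u) ≈w suffix j u
  u'≈ zero = cong u (sym (+-identityʳ j))
  u'≈ (suc k) = cong u (sym (+-suc j k))

letterChange⇒blockStart : ∀ {x u} → IsDelta x u → ∀ n → x n ≢ x (suc n) →
                          Σ ℕ λ k → blockStart u k ≡ suc n
letterChange⇒blockStart {x} {u} D n x≢ with locate (proj₁ D) (suc n)
... | k , zero , _ , eq = k , trans (sym (+-identityʳ _)) eq
... | k , suc t , t+1<uk , eq = ⊥-elim (x≢ (begin
  x n                           ≡⟨ cong x (sym (suc-injective (trans (sym (+-suc (blockStart u k) t)) eq))) ⟩
  x (blockStart u k + t)        ≡⟨ proj₁ (proj₂ D) k t (<-trans (n<1+n t) t+1<uk) ⟩
  x (blockStart u k)            ≡⟨ sym (proj₁ (proj₂ D) k (suc t) t+1<uk) ⟩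
  x (blockStart u k + suc t)    ≡⟨ cong x eq ⟩
  x (suc n)                     ∎))
  where open ≡-Reasoning

blockStart-ones : ∀ u j n → (∀ r → r < n → u (j + r) ≡ 1) →
                  ∀ r → r ≤ n → blockStart u (j + r) ≡ blockStart u j + r
blockStart-ones u j n ones zero _ = trans (cong (blockStart u) (+-identityʳ j)) (sym (+-identityʳ _))
blockStart-ones u j n ones (suc r) r<n = begin
  blockStart u (j + suc r)                ≡⟨ cong (blockStart u) (+-suc j r) ⟩
  blockStart u (j + r) + u (j + r)        ≡⟨ cong₂ _+_ (blockStart-ones u j n ones r (<⇒≤ r<n)) (ones r r<n) ⟩
  blockStart u j + r + 1                  ≡⟨ trans (+-assoc (blockStart u j) r 1) (cong (blockStart u j +_) (+-comm r 1)) ⟩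
  blockStart u j + suc r                  ∎
  where open ≡-Reasoning

module Alphabet (b : ℕ) (1<b : 1 < b) where

  Letter : ℕ → Set
  Letter a = a ≡ 1 ⊎ a ≡ b

  1≢b : 1 ≢ b
  1≢b = <⇒≢ 1<b

  letter-pos : ∀ {a} → Letter a → 1 ≤ a
  letter-pos (inj₁ refl) = ≤-refl
  letter-pos (inj₂ refl) = <⇒≤ 1<b

  letter-< : ∀ {a c} → Letter a → Letter c → a < c → a ≡ 1 × c ≡ b
  letter-< (inj₁ refl) (inj₁ refl) a<c = ⊥-elim (<-irrefl refl a<c)
  letter-< (inj₁ refl) (inj₂ refl) a<c = refl , refl
  letter-< (inj₂ refl) (inj₁ refl) a<c = ⊥-elim (<-asym a<c 1<b)
  letter-< (inj₂ refl) (inj₂ refl) a<c = ⊥-elim (<-irrefl refl a<c)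

  letter->1 : ∀ {a} → Letter a → 1 < a → a ≡ b
  letter->1 (inj₁ refl) 1<1 = ⊥-elim (<-irrefl refl 1<1)
  letter->1 (inj₂ a≡b) _ = a≡b

  -- Swaps the letters 1 and b (junk elsewhere).
  flip : ℕ → ℕ
  flip a = suc b ∸ a

  flip-b : flip b ≡ 1
  flip-b = m+n∸n≡m 1 b

  flip-letter : ∀ {a} → Letter a → Letter (flip a)
  flip-letter (inj₁ refl) = inj₂ refl
  flip-letter (inj₂ refl) = inj₁ flip-b

  flip-involutive : ∀ {a} → Letter a → flip (flip a) ≡ a
  flip-involutive (inj₁ refl) = flip-b
  flip-involutive (inj₂ refl) = cong flip flip-b

  flip-injective : ∀ {a c} → Letter a → Letter c → flip a ≡ flip c → a ≡ c
  flip-injective la lc eq = trans (sym (flip-involutive la)) (trans (cong flip eq) (flip-involutive lc))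

  flip-≢ : ∀ {a} → Letter a → flip a ≢ a
  flip-≢ (inj₁ refl) eq = 1≢b (sym eq)
  flip-≢ (inj₂ refl) eq = 1≢b (trans (sym flip-b) eq)

  ≢⇒≡flip : ∀ {a c} → Letter a → Letter c → c ≢ a → c ≡ flip a
  ≢⇒≡flip (inj₁ refl) (inj₁ refl) c≢a = ⊥-elim (c≢a refl)
  ≢⇒≡flip (inj₁ refl) (inj₂ refl) c≢a = refl
  ≢⇒≡flip (inj₂ refl) (inj₁ refl) c≢a = sym flip-b
  ≢⇒≡flip (inj₂ refl) (inj₂ refl) c≢a = ⊥-elim (c≢a refl)

  flipIf : Parity → ℕ → ℕ
  flipIf 0ℙ a = a
  flipIf 1ℙ a = flip a

  blockLetter : ℕ → ℕ → ℕ
  blockLetter a j = flipIf (parity j) a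

  blockLetter-even : ∀ a j → parity j ≡ 0ℙ → blockLetter a j ≡ a
  blockLetter-even a j eq = cong (λ p → flipIf p a) eq

  blockLetter-odd : ∀ a j → parity j ≡ 1ℙ → blockLetter a j ≡ flip a
  blockLetter-odd a j eq = cong (λ p → flipIf p a) eq

  blockLetter-suc : ∀ {a} → Letter a → ∀ j → blockLetter a (suc j) ≡ flip (blockLetter a j)
  blockLetter-suc {a} la j rewrite parity-suc j with parity j
  ... | 0ℙ = refl
  ... | 1ℙ = sym (flip-involutive la)

  blockLetter-letter : ∀ {a} → Letter a → ∀ j → Letter (blockLetter a j)
  blockLetter-letter {a} la j with parity j
  ... | 0ℙ = la
  ... | 1ℙ = flip-letter la

  module _ {x u : Word} (ox : Over b x) (D : IsDelta x u) where

    letter-blockStart : ∀ j → x (blockStart u j) ≡ blockLetter (x 0) j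
    letter-blockStart zero = refl
    letter-blockStart (suc j) =
      trans (≢⇒≡flip (ox _) (ox _) (proj₂ (proj₂ D) j))
            (trans (cong flip (letter-blockStart j)) (sym (blockLetter-suc (ox 0) j)))

    letter-inBlock : ∀ j t → t < u j → x (blockStart u j + t) ≡ blockLetter (x 0) j
    letter-inBlock j t t<uj = trans (proj₁ (proj₂ D) j t t<uj) (letter-blockStart j)

  over-flip : ∀ {x} → Over b x → Over b (λ n → flip (x n))
  over-flip ox n = flip-letter (ox n)

  Δ-flip : ∀ {x u} → Over b x → IsDelta x u → IsDelta (λ n → flip (x n)) u
  Δ-flip ox (pos , const , change) =
    pos , (λ n i i<un → cong flip (const n i i<un)) , (λ n eq → change n (flip-injective (ox _) (ox _) eq))

  module _ {x x' u u' : Word} (ox : Over b x) (ox' : Over b x') (D : IsDelta x u) (D' : IsDelta x' u')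
           (x₀≡x'₀ : x 0 ≡ x' 0) where

    private
      sameBlock : ∀ j t → blockStart u j ≡ blockStart u' j → t < u j → t < u' j →
                  x (blockStart u j + t) ≡ x' (blockStart u j + t)
      sameBlock j t bs≡ t<uj t<u'j = begin
        x (blockStart u j + t)   ≡⟨ letter-inBlock ox D j t t<uj ⟩
        blockLetter (x 0) j      ≡⟨ cong (λ a → blockLetter a j) x₀≡x'₀ ⟩
        blockLetter (x' 0) j     ≡⟨ sym (letter-inBlock ox' D' j t t<u'j) ⟩
        x' (blockStart u' j + t) ≡⟨ cong (λ p → x' (p + t)) (sym bs≡) ⟩
        x' (blockStart u j + t)  ∎
        where open ≡-Reasoning

    Δ-agree : ∀ J → u ≈[ J ] u' → x ≈[ blockStart u J ] x'
    Δ-agree J u≈u' n n<bsJ with locate (proj₁ D) n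
    ... | j , t , t<uj , refl with j <? J
    ...   | yes j<J = sameBlock j t (blockStart-agree j (λ i i<j → u≈u' i (<-trans i<j j<J)))
                                t<uj (subst (t <_) (u≈u' j j<J) t<uj)
    ...   | no j≮J = ⊥-elim (<-irrefl refl
              (≤-trans n<bsJ (≤-trans (blockStart-mono u (≮⇒≥ j≮J)) (m≤m+n _ t))))

    Δ-firstDifference : ∀ e → u ≈[ e ] u' → u e ≡ 1 → u' e ≡ b →
                        x ≈[ suc (blockStart u e) ] x' ×
                        x (suc (blockStart u e)) ≡ flip (blockLetter (x 0) e) ×
                        x' (suc (blockStart u e)) ≡ blockLetter (x 0) e
    Δ-firstDifference e u≈u' ue≡1 u'e≡b = agree , x-next , x'-next
      where
      bs≡ : blockStart u e ≡ blockStart u' e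
      bs≡ = blockStart-agree e u≈u'
      x-next : x (suc (blockStart u e)) ≡ flip (blockLetter (x 0) e)
      x-next = begin
        x (suc (blockStart u e))        ≡⟨ cong x (trans (+-comm 1 _) (cong (blockStart u e +_) (sym ue≡1))) ⟩
        x (blockStart u (suc e))        ≡⟨ letter-blockStart ox D (suc e) ⟩
        blockLetter (x 0) (suc e)       ≡⟨ blockLetter-suc (ox 0) e ⟩
        flip (blockLetter (x 0) e)      ∎
        where open ≡-Reasoning
      x'-next : x' (suc (blockStart u e)) ≡ blockLetter (x 0) e
      x'-next = begin
        x' (suc (blockStart u e))       ≡⟨ cong x' (trans (+-comm 1 _) (cong (_+ 1) bs≡)) ⟩
        x' (blockStart u' e + 1)        ≡⟨ letter-inBlock ox' D' e 1 (subst (1 <_) (sym u'e≡b) 1<b) ⟩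
        blockLetter (x' 0) e            ≡⟨ cong (λ a → blockLetter a e) (sym x₀≡x'₀) ⟩
        blockLetter (x 0) e             ∎
        where open ≡-Reasoning
      agree : x ≈[ suc (blockStart u e) ] x'
      agree i i<1+bs with m≤n⇒m<n∨m≡n (≤-pred i<1+bs)
      ... | inj₁ i<bs = Δ-agree e u≈u' i i<bs
      ... | inj₂ refl = trans (cong x (sym (+-identityʳ _)))
              (trans (sameBlock e 0 bs≡ (proj₁ D e) (proj₁ D' e)) (cong x' (+-identityʳ _)))

  -- A word starting with 1 is smaller when its first differing run is a shorter run of b's
  -- (odd index) or a longer run of 1's (even index).
  <lex-viaΔ : ∀ {x x' u u'} → Over b x → Over b x' → IsDelta x u → IsDelta x' u' → x 0 ≡ 1 → x' 0 ≡ 1 →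
              ∀ d → u ≈[ d ] u' →
              (u d ≡ 1 × u' d ≡ b × parity d ≡ 1ℙ) ⊎ (u d ≡ b × u' d ≡ 1 × parity d ≡ 0ℙ) →
              x <lex x'
  <lex-viaΔ {x} {x'} ox ox' D D' x₀≡1 x'₀≡1 d u≈u' (inj₁ (ud≡1 , u'd≡b , odd))
    with Δ-firstDifference ox ox' D D' (trans x₀≡1 (sym x'₀≡1)) d u≈u' ud≡1 u'd≡b
  ... | agree , x-next , x'-next = _ , agree , subst₂ _<_ (sym x≡1) (sym x'≡b) 1<b
    where
    block-b : blockLetter _ d ≡ b
    block-b = trans (cong (λ a → blockLetter a d) x₀≡1) (blockLetter-odd 1 d odd)
    x≡1 : x _ ≡ 1
    x≡1 = trans x-next (trans (cong flip block-b) flip-b)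
    x'≡b : x' _ ≡ b
    x'≡b = trans x'-next block-b
  <lex-viaΔ {x} {x'} ox ox' D D' x₀≡1 x'₀≡1 d u≈u' (inj₂ (ud≡b , u'd≡1 , even))
    with Δ-firstDifference ox' ox D' D (trans x'₀≡1 (sym x₀≡1)) d (≈[]-sym u≈u') u'd≡1 ud≡b
  ... | agree , x'-next , x-next = _ , ≈[]-sym agree , subst₂ _<_ (sym x≡1) (sym x'≡b) 1<b
    where
    block-1 : blockLetter _ d ≡ 1
    block-1 = trans (cong (λ a → blockLetter a d) x'₀≡1) (blockLetter-even 1 d even)
    x≡1 : x _ ≡ 1
    x≡1 = trans x-next block-1
    x'≡b : x' _ ≡ b
    x'≡b = trans x'-next (cong flip block-1)

  decode : ℕ → (v : Word) → Over b v → Word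
  decode a v ov n = blockLetter a (proj₁ (locate (λ i → letter-pos (ov i)) n))

  module _ {a : ℕ} (la : Letter a) {v : Word} (ov : Over b v) where

    private
      pos : Positive v
      pos i = letter-pos (ov i)

    decode-inBlock : ∀ j t → t < v j → decode a v ov (blockStart v j + t) ≡ blockLetter a j
    decode-inBlock j t t<vj with locate pos (blockStart v j + t)
    ... | j' , t' , t'<vj' , eq = cong (blockLetter a) (inBlock-index-unique v t'<vj' t<vj eq)

    decode-over : Over b (decode a v ov)
    decode-over n = blockLetter-letter la (proj₁ (locate pos n))

    decode-Δ : IsDelta (decode a v ov) v
    decode-Δ = pos , const , change
      where
      at-start : ∀ j → decode a v ov (blockStart v j) ≡ blockLetter a j
      at-start j = trans (cong (decode a v ov) (sym (+-identityʳ (blockStart v j)))) (decode-inBlock j 0 (pos j))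
      const : ∀ j i → i < v j → decode a v ov (blockStart v j + i) ≡ decode a v ov (blockStart v j)
      const j i i<vj = trans (decode-inBlock j i i<vj) (sym (at-start j))
      change : ∀ j → decode a v ov (blockStart v (suc j)) ≢ decode a v ov (blockStart v j)
      change j eq = flip-≢ (blockLetter-letter la j)
        (trans (sym (blockLetter-suc la j)) (trans (sym (at-start (suc j))) (trans eq (at-start j))))

  smallerSuffix-head : ∀ {x} → Over b x → x 0 ≡ 1 → ∀ P → suffix P x <lex x → x P ≡ 1
  smallerSuffix-head {x} ox x₀≡1 P (zero , _ , lt) =
    ⊥-elim (<⇒≱ (subst (x (P + 0) <_) x₀≡1 lt) (letter-pos (ox _)))
  smallerSuffix-head {x} ox x₀≡1 P (suc _ , agree , _) =
    trans (cong x (sym (+-identityʳ P))) (trans (agree 0 (s≤s z≤n)) x₀≡1)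

  longRun : ∀ {x u} → Over b x → Over b u → IsDelta x u →
            ∀ n → x n ≢ x (suc n) → x (suc n) ≡ x (suc (suc n)) →
            ∀ r → r < b → x (suc n + r) ≡ x (suc n)
  longRun {x} {u} ox ou D n x≢ same r r<b with letterChange⇒blockStart D n x≢
  ... | k , bsk≡n+1 = begin
    x (suc n + r)                ≡⟨ cong (λ p → x (p + r)) (sym bsk≡n+1) ⟩
    x (blockStart u k + r)       ≡⟨ proj₁ (proj₂ D) k r (subst (r <_) (sym uk≡b) r<b) ⟩
    x (blockStart u k)           ≡⟨ cong x bsk≡n+1 ⟩
    x (suc n)                    ∎
    where
    open ≡-Reasoning
    uk≡b : u k ≡ b
    uk≡b with ou k
    ... | inj₂ uk≡b = uk≡b
    ... | inj₁ uk≡1 = ⊥-elim (proj₂ (proj₂ D) k (begin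
      x (blockStart u k + u k)   ≡⟨ cong (λ p → x (p + u k)) bsk≡n+1 ⟩
      x (suc n + u k)            ≡⟨ cong (λ l → x (suc n + l)) uk≡1 ⟩
      x (suc n + 1)              ≡⟨ cong x (+-comm (suc n) 1) ⟩
      x (suc (suc n))            ≡⟨ sym same ⟩
      x (suc n)                  ≡⟨ cong x (sym bsk≡n+1) ⟩
      x (blockStart u k)         ∎))

  <lex-suffixInOddBlock : ∀ {x v} → Over b x → IsDelta x v → x 0 ≡ 1 →
                          ∀ j t → t < v j → parity j ≡ 1ℙ → x <lex suffix (blockStart v j + t) x
  <lex-suffixInOddBlock {x} {v} ox D x₀≡1 j t t<vj odd = 0 , (λ _ ()) , subst₂ _<_ (sym x₀≡1) (sym starts-b) 1<b
    where
    starts-b : x (blockStart v j + t + 0) ≡ b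
    starts-b = trans (cong x (+-identityʳ _))
                 (trans (letter-inBlock ox D j t t<vj) (trans (cong (λ a → blockLetter a j) x₀≡1) (blockLetter-odd 1 j odd)))

  -- A suffix starting strictly inside a block of 1's sees fewer than b leading 1's,
  -- while x itself starts with b of them.
  <lex-suffixInside1Block : ∀ {x v} → Over b x → Over b v → IsDelta x v → x 0 ≡ 1 → v 0 ≡ b →
                            ∀ j t → suc t < v j → parity j ≡ 0ℙ → x <lex suffix (blockStart v j + suc t) x
  <lex-suffixInside1Block {x} {v} ox ov D x₀≡1 v₀≡b j t t+1<vj even =
    q , agree , subst₂ _<_ (sym (x-prefix q q<b)) (sym x'q≡b) 1<b
    where
    vj≡b : v j ≡ b
    vj≡b = letter->1 (ov j) (≤-<-trans (s≤s z≤n) t+1<vj)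
    t+1≤b : suc t ≤ b
    t+1≤b = subst (suc t ≤_) vj≡b (<⇒≤ t+1<vj)
    q : ℕ
    q = b ∸ suc t
    q<b : q < b
    q<b = ∸-monoʳ-< (s≤s z≤n) t+1≤b
    p : ℕ
    p = blockStart v j + suc t
    x-prefix : ∀ i → i < b → x i ≡ 1
    x-prefix i i<b = trans (letter-inBlock ox D 0 i (subst (i <_) (sym v₀≡b) i<b)) x₀≡1
    x'-prefix : ∀ i → i < q → x (p + i) ≡ 1
    x'-prefix i i<q = begin
      x (p + i)                          ≡⟨ cong x (+-assoc (blockStart v j) (suc t) i) ⟩
      x (blockStart v j + (suc t + i))   ≡⟨ letter-inBlock ox D j (suc t + i) in-block ⟩
      blockLetter (x 0) j                ≡⟨ trans (cong (λ a → blockLetter a j) x₀≡1) (blockLetter-even 1 j even) ⟩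
      1                                  ∎
      where
      open ≡-Reasoning
      in-block : suc t + i < v j
      in-block = subst (suc t + i <_) (trans (m+[n∸m]≡n t+1≤b) (sym vj≡b)) (+-monoʳ-< (suc t) i<q)
    agree : x ≈[ q ] suffix p x
    agree i i<q = trans (x-prefix i (<-trans i<q q<b)) (sym (x'-prefix i i<q))
    x'q≡b : x (p + q) ≡ b
    x'q≡b = begin
      x (p + q)                          ≡⟨ cong x (trans (+-assoc (blockStart v j) (suc t) q)
                                              (cong (blockStart v j +_) (trans (m+[n∸m]≡n t+1≤b) (sym vj≡b)))) ⟩
      x (blockStart v (suc j))           ≡⟨ letter-blockStart ox D (suc j) ⟩
      blockLetter (x 0) (suc j)          ≡⟨ blockLetter-suc (ox 0) j ⟩
      flip (blockLetter (x 0) j)         ≡⟨ cong flip (trans (cong (λ a → blockLetter a j) x₀≡1) (blockLetter-even 1 j even)) ⟩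
      b                                  ∎
      where open ≡-Reasoning

module OddAlphabet (b : ℕ) (1<b : 1 < b) (b-odd : parity b ≡ 1ℙ) where

  open Alphabet b 1<b

  letter-odd : ∀ {a} → Letter a → parity a ≡ 1ℙ
  letter-odd (inj₁ refl) = refl
  letter-odd (inj₂ refl) = b-odd

  parity-blockStart : ∀ {u} → Over b u → ∀ j → parity (blockStart u j) ≡ parity j
  parity-blockStart ou zero = refl
  parity-blockStart {u} ou (suc j) = begin
    parity (blockStart u j + u j)            ≡⟨ ℙ.+-homo-+ (blockStart u j) (u j) ⟩
    parity (blockStart u j) ℙ.+ parity (u j) ≡⟨ cong₂ ℙ._+_ (parity-blockStart ou j) (letter-odd (ou j)) ⟩
    parity j ℙ.+ 1ℙ                          ≡⟨ ℙ.+-comm (parity j) 1ℙ ⟩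
    parity j ⁻¹                              ≡⟨ sym (parity-suc j) ⟩
    parity (suc j)                           ∎
    where open ≡-Reasoning

  2<b : 2 < b
  2<b with m≤n⇒m<n∨m≡n 1<b
  ... | inj₁ 2<b = 2<b
  ... | inj₂ 2≡b = ⊥-elim (ℙ.p≢p⁻¹ 0ℙ (trans (cong parity 2≡b) b-odd))

  2+[b∸2]≡b : 2 + (b ∸ 2) ≡ b
  2+[b∸2]≡b = m+[n∸m]≡n (<⇒≤ 2<b)

  parity-b∸2 : parity (b ∸ 2) ≡ 1ℙ
  parity-b∸2 = trans (cong parity 2+[b∸2]≡b) b-odd

  b∸1<b : suc (b ∸ 2) < b
  b∸1<b = subst (suc (b ∸ 2) <_) 2+[b∸2]≡b ≤-refl

  parity-b+ : ∀ r → parity (b + r) ≡ parity r ⁻¹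
  parity-b+ r = trans (ℙ.+-homo-+ b r) (cong (ℙ._+ parity r) b-odd)

  parity-b∸1 : parity (suc (b ∸ 2)) ≡ 0ℙ
  parity-b∸1 = trans (parity-suc (b ∸ 2)) (cong _⁻¹ parity-b∸2)

  b∸2<b : b ∸ 2 < b
  b∸2<b = <-trans (n<1+n _) b∸1<b

  -- Two levels down, the parity of the first differing run decides which letter the first
  -- differing run one level down repeats, because block starts have the parity of their index.
  <lex-viaΔ² : ∀ {x x' v v' u u'} → Over b x → Over b x' → Over b v → Over b v' → Over b u →
               IsDelta x v → IsDelta x' v' → IsDelta v u → IsDelta v' u' →
               x 0 ≡ 1 → x' 0 ≡ 1 → v 0 ≡ b → v' 0 ≡ b →
               ∀ e → u ≈[ e ] u' → u e ≡ 1 → u' e ≡ b → x <lex x'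
  <lex-viaΔ² {v = v} {v'} {u} ox ox' ov ov' ou D D' E E' x₀≡1 x'₀≡1 v₀≡b v'₀≡b e u≈u' ue≡1 u'e≡b
    with Δ-firstDifference ov ov' E E' (trans v₀≡b (sym v'₀≡b)) e u≈u' ue≡1 u'e≡b
  ... | v≈v' , v-next , v'-next = <lex-viaΔ ox ox' D D' x₀≡1 x'₀≡1 _ v≈v' (by-parity (parity e) refl)
    where
    q : ℕ
    q = suc (blockStart u e)
    parity-q : parity q ≡ parity e ⁻¹
    parity-q = trans (parity-suc (blockStart u e)) (cong _⁻¹ (parity-blockStart ou e))
    block : ∀ {p} → parity e ≡ p → blockLetter (v 0) e ≡ flipIf p b
    block pe = trans (cong (λ a → blockLetter a e) v₀≡b) (cong (λ p → flipIf p b) pe)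
    by-parity : ∀ p → parity e ≡ p →
                (v q ≡ 1 × v' q ≡ b × parity q ≡ 1ℙ) ⊎ (v q ≡ b × v' q ≡ 1 × parity q ≡ 0ℙ)
    by-parity 0ℙ even = inj₁ (trans v-next (trans (cong flip (block even)) flip-b) ,
                              trans v'-next (block even) ,
                              trans parity-q (cong _⁻¹ even))
    by-parity 1ℙ odd = inj₂ (trans v-next (trans (cong flip (block odd)) (flip-involutive (inj₂ refl))) ,
                             trans v'-next (trans (block odd) flip-b) ,
                             trans parity-q (cong _⁻¹ odd))

  Tower : (ℕ → Word) → Set
  Tower X = (∀ k → Over b (X k)) × (∀ k → IsDelta (X k) (X (suc k)))

  shift : (ℕ → Word) → ℕ → Word
  shift X k = X (suc k)

  tower-shift : ∀ {X} → Tower X → Tower (shift X)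
  tower-shift (over , Δ) = (λ k → over (suc k)) , (λ k → Δ (suc k))

  tower-◂ : ∀ {x X} → Over b x → IsDelta x (X 0) → Tower X → Tower (x ◂ X)
  tower-◂ {x} {X} ox D (over , Δ) = over' , Δ'
    where
    over' : ∀ k → Over b ((x ◂ X) k)
    over' zero = ox
    over' (suc k) = over k
    Δ' : ∀ k → IsDelta ((x ◂ X) k) ((x ◂ X) (suc k))
    Δ' zero = D
    Δ' (suc k) = Δ k

  tower⇒smooth : ∀ {X} → Tower X → Smooth b (X 0)
  tower⇒smooth T = _ , (λ _ → refl) , T

  Minimal : Word → Set
  Minimal x = ∀ y → Smooth b y → ¬ (y <lex x)

  minimal-resp-≈ : ∀ {x x'} → x ≈w x' → Minimal x → Minimal x'
  minimal-resp-≈ x≈x' min y sy y<x' = min y sy (<lex-resp-≈ (λ _ → refl) (λ n → sym (x≈x' n)) y<x')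

  module _ {X : ℕ → Word} (T : Tower X) (min : Minimal (X 0)) where

    private
      over : ∀ k → Over b (X k)
      over = proj₁ T
      Δ : ∀ k → IsDelta (X k) (X (suc k))
      Δ = proj₂ T

    -- Otherwise flipping every letter of X 0 gives a smaller smooth word.
    minimal-head≡1 : X 0 0 ≡ 1
    minimal-head≡1 with over 0 0
    ... | inj₁ x₀≡1 = x₀≡1
    ... | inj₂ x₀≡b = ⊥-elim (min _ (tower⇒smooth flipped) (0 , (λ _ ()) , flip-x₀<x₀))
      where
      flipped : Tower ((λ n → flip (X 0 n)) ◂ shift X)
      flipped = tower-◂ (over-flip (over 0)) (Δ-flip (over 0) (Δ 0)) (tower-shift T)
      flip-x₀<x₀ : flip (X 0 0) < X 0 0
      flip-x₀<x₀ = subst₂ _<_ (sym (trans (cong flip x₀≡b) flip-b)) (sym x₀≡b) 1<b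

    -- Otherwise flipping every letter of X 1 and decoding gives a smaller smooth word.
    minimal-Δhead≡b : X 1 0 ≡ b
    minimal-Δhead≡b with over 1 0
    ... | inj₂ v₀≡b = v₀≡b
    ... | inj₁ v₀≡1 = ⊥-elim (min _ (tower⇒smooth T') smaller)
      where
      ov' : Over b (λ n → flip (X 1 n))
      ov' = over-flip (over 1)
      T' : Tower (decode 1 _ ov' ◂ ((λ n → flip (X 1 n)) ◂ shift (shift X)))
      T' = tower-◂ (decode-over (inj₁ refl) ov') (decode-Δ (inj₁ refl) ov')
             (tower-◂ ov' (Δ-flip (over 1) (Δ 1)) (tower-shift (tower-shift T)))
      smaller : decode 1 _ ov' <lex X 0
      smaller = <lex-viaΔ (decode-over (inj₁ refl) ov') (over 0) (decode-Δ (inj₁ refl) ov') (Δ 0)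
                  refl minimal-head≡1 0 (λ _ ()) (inj₂ (cong flip v₀≡1 , v₀≡1 , refl))

    -- A smooth word below X 2 would decode twice into a smooth word below X 0.
    minimal-Δ² : Minimal (X 2)
    minimal-Δ² y (Y , Y₀≈y , overY , ΔY) y<u with <lex-resp-≈ (λ n → sym (Y₀≈y n)) (λ _ → refl) y<u
    ... | e , Y₀≈u , Y₀e<ue with letter-< (overY 0 e) (over 2 e) Y₀e<ue
    ...   | Y₀e≡1 , ue≡b = min _ (tower⇒smooth T') smaller
      where
      ov' : Over b (decode b (Y 0) (overY 0))
      ov' = decode-over (inj₂ refl) (overY 0)
      T' : Tower (decode 1 _ ov' ◂ (decode b (Y 0) (overY 0) ◂ Y))
      T' = tower-◂ (decode-over (inj₁ refl) ov') (decode-Δ (inj₁ refl) ov')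
             (tower-◂ ov' (decode-Δ (inj₂ refl) (overY 0)) (overY , ΔY))
      smaller : decode 1 _ ov' <lex X 0
      smaller = <lex-viaΔ² (decode-over (inj₁ refl) ov') (over 0) ov' (over 1) (overY 0)
                  (decode-Δ (inj₁ refl) ov') (Δ 0) (decode-Δ (inj₂ refl) (overY 0)) (Δ 1)
                  refl minimal-head≡1 refl minimal-Δhead≡b e Y₀≈u Y₀e≡1 ue≡b

  AlternatingHeads : (ℕ → Word) → Set
  AlternatingHeads X = ∀ k → X k 0 ≡ blockLetter 1 k

  alternatingHeads : (P : (ℕ → Word) → Set) →
                     (∀ {X} → Tower X → P X → X 0 0 ≡ 1 × X 1 0 ≡ b × P (shift (shift X))) →
                     ∀ {X} → Tower X → P X → AlternatingHeads X
  alternatingHeads P step T p zero = proj₁ (step T p)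
  alternatingHeads P step T p (suc zero) = proj₁ (proj₂ (step T p))
  alternatingHeads P step T p (suc (suc k)) =
    alternatingHeads P step (tower-shift (tower-shift T)) (proj₂ (proj₂ (step T p))) k

  minimal-alternatingHeads : ∀ {X} → Tower X → Minimal (X 0) → AlternatingHeads X
  minimal-alternatingHeads =
    alternatingHeads (λ X → Minimal (X 0)) (λ T min → minimal-head≡1 T min , minimal-Δhead≡b T min , minimal-Δ² T min)

  alternatingHeads-determine : ∀ {X M} → Tower X → Tower M → AlternatingHeads X → AlternatingHeads M → X 0 ≈w M 0
  alternatingHeads-determine TX TM hX hM n = proj₁ (agree (suc n) TX TM hX hM) n ≤-refl
    where
    Agree₀₁ : ℕ → (ℕ → Word) → (ℕ → Word) → Set
    Agree₀₁ n X M = X 0 ≈[ n ] M 0 × X 1 ≈[ n ] M 1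
    lift : ∀ {X M} → Tower X → Tower M → X 0 0 ≡ M 0 0 → ∀ n → X 1 ≈[ n ] M 1 → X 0 ≈[ blockStart (X 1) n ] M 0
    lift (oX , ΔX) (oM , ΔM) heads n = Δ-agree (oX 0) (oM 0) (ΔX 0) (ΔM 0) heads n
    level₀ : ∀ {X M} → Tower X → Tower M → AlternatingHeads X → AlternatingHeads M →
             ∀ n → X 1 ≈[ n ] M 1 → X 0 ≈[ suc n ] M 0
    level₀ TX TM hX hM zero _ zero _ = trans (hX 0) (sym (hM 0))
    level₀ TX TM hX hM zero _ (suc i) (s≤s ())
    level₀ {X} TX TM hX hM (suc n) agree₁ i i<n+2 =
      lift TX TM (trans (hX 0) (sym (hM 0))) (suc n) agree₁ i (<-≤-trans i<n+2 long)
      where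
      long : suc (suc n) ≤ blockStart (X 1) (suc n)
      long = ≤-trans (≤-reflexive (+-comm 2 n))
               (≤-trans (+-monoʳ-≤ n (subst (2 ≤_) (sym (hX 1)) (<⇒≤ 2<b))) (n+u₀≤blockStart (proj₁ (proj₂ TX 0)) n))
    level₁ : ∀ {X M} → Tower X → Tower M → AlternatingHeads X → AlternatingHeads M →
             ∀ n → X 2 ≈[ n ] M 2 → X 1 ≈[ n ] M 1
    level₁ {X} TX TM hX hM n agree₂ i i<n =
      lift (tower-shift TX) (tower-shift TM) (trans (hX 1) (sym (hM 1))) n agree₂ i
        (<-≤-trans i<n (n≤blockStart (proj₁ (proj₂ TX 1)) n))
    agree : ∀ n {X M} → Tower X → Tower M → AlternatingHeads X → AlternatingHeads M → Agree₀₁ n X M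
    agree zero TX TM hX hM = (λ _ ()) , (λ _ ())
    agree (suc n) {X} {M} TX TM hX hM =
      level₀ TX TM hX hM n (proj₂ (agree n TX TM hX hM)) , level₁ TX TM hX hM (suc n) agree₂
      where
      TX₂ : Tower (shift (shift X))
      TX₂ = tower-shift (tower-shift TX)
      TM₂ : Tower (shift (shift M))
      TM₂ = tower-shift (tower-shift TM)
      hX₂ : AlternatingHeads (shift (shift X))
      hX₂ k = hX (2 + k)
      hM₂ : AlternatingHeads (shift (shift M))
      hM₂ k = hM (2 + k)
      agree₂ : X 2 ≈[ suc n ] M 2
      agree₂ = level₀ TX₂ TM₂ hX₂ hM₂ n (proj₂ (agree n TX₂ TM₂ hX₂ hM₂))

  -- A block of b's starts at an odd position and has odd length, so it does not end at an even position.
  b-atEven⇒next-b : ∀ {u y} → Over b u → Over b y → IsDelta u y → u 0 ≡ 1 →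
                    ∀ i → parity i ≡ 0ℙ → u i ≡ b → u (suc i) ≡ b
  b-atEven⇒next-b {u} {y} ou oy D u₀≡1 i even ui≡b with ou (suc i)
  ... | inj₂ next≡b = next≡b
  ... | inj₁ next≡1 with letterChange⇒blockStart D i (λ eq → 1≢b (trans (sym next≡1) (trans (sym eq) ui≡b)))
  ...   | k , bsk≡i+1 = ⊥-elim (1≢b (begin
    1                           ≡⟨ sym next≡1 ⟩
    u (suc i)                   ≡⟨ cong u (sym bsk≡i+1) ⟩
    u (blockStart y k)          ≡⟨ letter-blockStart ou D k ⟩
    blockLetter (u 0) k         ≡⟨ trans (cong (λ a → blockLetter a k) u₀≡1) (blockLetter-odd 1 k k-odd) ⟩
    b                           ∎))
    where
    open ≡-Reasoning
    k-odd : parity k ≡ 1ℙ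
    k-odd = begin
      parity k                  ≡⟨ sym (parity-blockStart oy k) ⟩
      parity (blockStart y k)   ≡⟨ cong parity bsk≡i+1 ⟩
      parity (suc i)            ≡⟨ parity-suc i ⟩
      parity i ⁻¹               ≡⟨ cong _⁻¹ even ⟩
      1ℙ                        ∎

  parity-inBlock : ∀ {u} → Over b u → ∀ i t → parity i ≡ 0ℙ → parity t ≡ 0ℙ → parity (blockStart u i + t) ≡ 0ℙ
  parity-inBlock ou i t i-even t-even =
    trans (ℙ.+-homo-+ (blockStart _ i) t) (cong₂ ℙ._+_ (trans (parity-blockStart ou i) i-even) t-even)

  -- lifted p is the suffix of w whose run-length sequence is the suffix of v from position p, and
  -- runs i t is the run-length sequence of the suffix of v from offset t in its i-th run.
  module TwoLevels {X : ℕ → Word} (T : Tower X) (w₀≡1 : X 0 0 ≡ 1) (v₀≡b : X 1 0 ≡ b) where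

    private
      over : ∀ k → Over b (X k)
      over = proj₁ T
      Δ : ∀ k → IsDelta (X k) (X (suc k))
      Δ = proj₂ T
      w : Word
      w = X 0
      v : Word
      v = X 1
      u : Word
      u = X 2

    lifted : ℕ → Word
    lifted p = suffix (blockStart v p) w

    lifted-over : ∀ p → Over b (lifted p)
    lifted-over p n = over 0 (blockStart v p + n)

    lifted-head : ∀ p → parity p ≡ 0ℙ → lifted p 0 ≡ 1
    lifted-head p even = trans (letter-inBlock (over 0) (Δ 0) p 0 (proj₁ (Δ 0) p))
                               (trans (cong (λ a → blockLetter a p) w₀≡1) (blockLetter-even 1 p even))

    lifted-start≥1 : ∀ p → 1 ≤ p → 1 ≤ blockStart v p
    lifted-start≥1 p 1≤p = ≤-trans 1≤p (n≤blockStart (proj₁ (Δ 0)) p)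

    runs : ℕ → ℕ → Word
    runs i t = (u i ∸ t) ◂ suffix (suc i) u

    suffix≈runs : ∀ i → suffix i u ≈w runs i 0
    suffix≈runs i zero = cong u (+-identityʳ i)
    suffix≈runs i (suc k) = cong u (+-suc i k)

    private
      suffix-v-head : ∀ i t → t < u i → parity i ≡ 0ℙ → suffix (blockStart u i + t) v 0 ≡ b
      suffix-v-head i t t<ui even = begin
        v (blockStart u i + t + 0)   ≡⟨ cong v (+-identityʳ _) ⟩
        v (blockStart u i + t)       ≡⟨ letter-inBlock (over 1) (Δ 1) i t t<ui ⟩
        blockLetter (v 0) i          ≡⟨ trans (cong (λ a → blockLetter a i) v₀≡b) (blockLetter-even b i even) ⟩
        b                            ∎
        where open ≡-Reasoning

    lifted<lex : ∀ i t → t < u i → parity i ≡ 0ℙ → parity (blockStart u i + t) ≡ 0ℙ →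
                 ∀ e → runs i t ≈[ e ] u → runs i t e ≡ 1 → u e ≡ b → lifted (blockStart u i + t) <lex w
    lifted<lex i t t<ui i-even p-even e runs≈u runs-e≡1 ue≡b =
      <lex-viaΔ² (lifted-over p) (over 0) (λ n → over 1 (p + n)) (over 1) runs-over
        (Δ-suffix-blockStart {w} (Δ 0) p) (Δ 0) (Δ-suffix {v} (Δ 1) i t t<ui) (Δ 1)
        (lifted-head p p-even) w₀≡1 (suffix-v-head i t t<ui i-even) v₀≡b e runs≈u runs-e≡1 ue≡b
      where
      p : ℕ
      p = blockStart u i + t
      runs-over : Over b (runs i t)
      runs-over (suc k) = over 2 (suc i + k)
      runs-over zero = head-letter e runs≈u runs-e≡1
        where
        head-letter : ∀ e → runs i t ≈[ e ] u → runs i t e ≡ 1 → Letter (runs i t 0)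
        head-letter zero _ runs₀≡1 = inj₁ runs₀≡1
        head-letter (suc _) runs≈u _ = subst Letter (sym (runs≈u 0 (s≤s z≤n))) (over 2 0)

    <lex-lifted : ∀ i t → t < u i → parity i ≡ 0ℙ → parity (blockStart u i + t) ≡ 0ℙ →
                  ∀ e → u ≈[ e ] runs i t → u e ≡ 1 → runs i t e ≡ b → w <lex lifted (blockStart u i + t)
    <lex-lifted i t t<ui i-even p-even e u≈runs ue≡1 runs-e≡b =
      <lex-viaΔ² (over 0) (lifted-over p) (over 1) (λ n → over 1 (p + n)) (over 2)
        (Δ 0) (Δ-suffix-blockStart {w} (Δ 0) p) (Δ 1) (Δ-suffix {v} (Δ 1) i t t<ui)
        w₀≡1 (lifted-head p p-even) v₀≡b (suffix-v-head i t t<ui i-even) e u≈runs ue≡1 runs-e≡b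
      where
      p : ℕ
      p = blockStart u i + t

  module _ {X : ℕ → Word} (T : Tower X) (heads : AlternatingHeads X) where

    open TwoLevels T (heads 0) (heads 1)

    private
      over : ∀ k → Over b (X k)
      over = proj₁ T
      Δ : ∀ k → IsDelta (X k) (X (suc k))
      Δ = proj₂ T
      w : Word
      w = X 0
      v : Word
      v = X 1
      u : Word
      u = X 2

    -- Locating j inside the i-th run of v: either the first level already decides, or the
    -- comparison u < suffix i u is transferred two levels up.
    <lex-lifted-evenBlock : ∀ j → 1 ≤ j → parity j ≡ 0ℙ → (∀ i → 1 ≤ i → i ≤ j → u <lex suffix i u) →
                            w <lex lifted j
    <lex-lifted-evenBlock j 1≤j j-even u-lyndon with locate (proj₁ (Δ 1)) j
    ... | i , t , t<ui , refl with parity i in i-parity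
    ...   | 1ℙ = <lex-viaΔ (over 0) (lifted-over j) (Δ 0) (Δ-suffix-blockStart {w} (Δ 0) j)
                   (heads 0) (lifted-head j j-even) 0 (λ _ ()) (inj₂ (heads 1 , v-at-j , refl))
      where
      v-at-j : v (j + 0) ≡ 1
      v-at-j = trans (cong v (+-identityʳ j))
                 (trans (letter-inBlock (over 1) (Δ 1) i t t<ui)
                   (trans (cong (λ a → blockLetter a i) (heads 1)) (trans (blockLetter-odd b i i-parity) flip-b)))
    <lex-lifted-evenBlock _ 1≤j j-even u-lyndon | zero , zero , _ , refl | 0ℙ with () ← 1≤j
    <lex-lifted-evenBlock _ 1≤j j-even u-lyndon | suc i , zero , t<ui , refl | 0ℙ
      with u-lyndon (suc i) (s≤s z≤n) (≤-trans (n≤blockStart (proj₁ (Δ 1)) (suc i)) (m≤m+n _ 0))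
    ... | e , u≈ , ue<u'e with letter-< (over 2 e) (over 2 (suc i + e)) ue<u'e
    ...   | ue≡1 , u'e≡b =
      <lex-lifted (suc i) 0 t<ui i-parity j-even e (λ k k<e → trans (u≈ k k<e) (suffix≈runs (suc i) k)) ue≡1
        (trans (sym (suffix≈runs (suc i) e)) u'e≡b)
    <lex-lifted-evenBlock _ 1≤j j-even u-lyndon | i , suc t , t<ui , refl | 0ℙ with suc (suc t) <? u i
    ... | yes t+2<ui = <lex-viaΔ (over 0) (lifted-over j) (Δ 0) (Δ-suffix-blockStart {w} (Δ 0) j)
                         (heads 0) (lifted-head j j-even) 1 v≈ (inj₁ (v₁≡1 , v-at-j+1 , refl))
      where
      j : ℕ
      j = blockStart u i + suc t
      v-inBlock : ∀ s → s < u i → v (blockStart u i + s) ≡ b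
      v-inBlock s s<ui = trans (letter-inBlock (over 1) (Δ 1) i s s<ui)
                           (trans (cong (λ a → blockLetter a i) (heads 1)) (blockLetter-even b i i-parity))
      v≈ : v ≈[ 1 ] suffix j v
      v≈ zero _ = trans (heads 1) (sym (trans (cong v (+-identityʳ j)) (v-inBlock (suc t) t<ui)))
      v≈ (suc _) (s≤s ())
      v₁≡1 : v 1 ≡ 1
      v₁≡1 = trans (cong v (sym (heads 2))) (trans (letter-blockStart (over 1) (Δ 1) 1) (trans (cong flip (heads 1)) flip-b))
      v-at-j+1 : v (j + 1) ≡ b
      v-at-j+1 = trans (cong v (trans (+-assoc (blockStart u i) (suc t) 1) (cong (blockStart u i +_) (+-comm (suc t) 1))))
                   (v-inBlock (suc (suc t)) t+2<ui)
    ... | no t+2≮ui = <lex-lifted i (suc t) t<ui i-parity j-even 1 u≈runs u₁≡1 runs₁≡b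
      where
      ui≡t+2 : u i ≡ suc (suc t)
      ui≡t+2 = ≤-antisym (≮⇒≥ t+2≮ui) t<ui
      u≈runs : u ≈[ 1 ] runs i (suc t)
      u≈runs zero _ = trans (heads 2) (sym (trans (cong (_∸ suc t) ui≡t+2) (m+n∸n≡m 1 (suc t))))
      u≈runs (suc _) (s≤s ())
      u₁≡1 : u 1 ≡ 1
      u₁≡1 = trans (letter-inBlock (over 2) (Δ 2) 0 1 (subst (1 <_) (sym (heads 3)) 1<b)) (heads 2)
      runs₁≡b : u (suc i + 0) ≡ b
      runs₁≡b = trans (cong u (+-identityʳ (suc i)))
                  (b-atEven⇒next-b (over 2) (over 3) (Δ 2) (heads 2) i i-parity
                    (letter->1 (over 2 i) (subst (1 <_) (sym ui≡t+2) (s≤s (s≤s z≤n)))))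

  minimal⇒lyndon : ∀ P {X} → Tower X → Minimal (X 0) → 1 ≤ P → X 0 <lex suffix P (X 0)
  minimal⇒lyndon = <-rec _ step
    where
    step : ∀ P → (∀ {P'} → P' < P → ∀ {X} → Tower X → Minimal (X 0) → 1 ≤ P' → X 0 <lex suffix P' (X 0)) →
           ∀ {X} → Tower X → Minimal (X 0) → 1 ≤ P → X 0 <lex suffix P (X 0)
    step P IH {X} T min 1≤P with locate (proj₁ (proj₂ T 0)) P
    ... | j , t , t<vj , eq =
      subst (λ p → X 0 <lex suffix p (X 0)) eq
            (by-block j t t<vj (parity j) refl (subst (1 ≤_) (sym eq) 1≤P) (≤-reflexive eq))
      where
      heads : AlternatingHeads X
      heads = minimal-alternatingHeads T min
      by-block : ∀ j t → t < X 1 j → ∀ p → parity j ≡ p → 1 ≤ blockStart (X 1) j + t → blockStart (X 1) j + t ≤ P →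
                 X 0 <lex suffix (blockStart (X 1) j + t) (X 0)
      by-block j t t<vj 1ℙ odd _ _ = <lex-suffixInOddBlock (proj₁ T 0) (proj₂ T 0) (heads 0) j t t<vj odd
      by-block j (suc t) t<vj 0ℙ even _ _ =
        <lex-suffixInside1Block (proj₁ T 0) (proj₁ T 1) (proj₂ T 0) (heads 0) (heads 1) j t t<vj even
      by-block zero zero _ 0ℙ _ () _
      by-block (suc j) zero _ 0ℙ even _ ≤P =
        subst (λ p → X 0 <lex suffix p (X 0)) (sym (+-identityʳ _))
              (<lex-lifted-evenBlock T heads (suc j) (s≤s z≤n) even u-lyndon)
        where
        u-lyndon : ∀ i → 1 ≤ i → i ≤ suc j → X 2 <lex suffix i (X 2)
        u-lyndon i 1≤i i≤j+1 = IH i<P (tower-shift (tower-shift T)) (minimal-Δ² T min) 1≤i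
          where
          i<P : i < P
          i<P = <-≤-trans (≤-<-trans i≤j+1 (j<blockStart (proj₁ (proj₂ T 0)) (subst (2 ≤_) (sym (heads 1)) (<⇒≤ 2<b))
                                                          (suc j) (s≤s z≤n)))
                          (≤-trans (m≤m+n _ 0) ≤P)

  module LyndonLevels {X : ℕ → Word} (T : Tower X) (nss : NoSmallerSuffix (X 0))
                      (w₀≡1 : X 0 0 ≡ 1) (v₀≡b : X 1 0 ≡ b) where

    open TwoLevels T w₀≡1 v₀≡b

    private
      over : ∀ k → Over b (X k)
      over = proj₁ T
      Δ : ∀ k → IsDelta (X k) (X (suc k))
      Δ = proj₂ T
      w : Word
      w = X 0
      v : Word
      v = X 1
      u : Word
      u = X 2
      y : Word
      y = X 3
      z : Word
      z = X 4

    -- Otherwise v starts with b b's and the suffix of w at the third run of w is smaller.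
    Δ²-head≡1 : u 0 ≡ 1
    Δ²-head≡1 with over 2 0
    ... | inj₁ u₀≡1 = u₀≡1
    ... | inj₂ u₀≡b = ⊥-elim (nss (blockStart v 2) (lifted-start≥1 2 (s≤s z≤n))
            (<lex-viaΔ (lifted-over 2) (over 0) (Δ-suffix-blockStart {w} (Δ 0) 2) (Δ 0) (lifted-head 2 refl) w₀≡1
                       (b ∸ 2) agree (inj₁ (v[b]≡1 , v-firstBlock (b ∸ 2) b∸2<b , parity-b∸2))))
      where
      v-firstBlock : ∀ k → k < b → v k ≡ b
      v-firstBlock k k<b = trans (letter-inBlock (over 1) (Δ 1) 0 k (subst (k <_) (sym u₀≡b) k<b)) v₀≡b
      agree : suffix 2 v ≈[ b ∸ 2 ] v
      agree k k<b-2 = trans (v-firstBlock (2 + k) (subst (2 + k <_) 2+[b∸2]≡b (+-monoʳ-< 2 k<b-2)))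
                            (sym (v-firstBlock k (<-trans k<b-2 b∸2<b)))
      v[b]≡1 : v (2 + (b ∸ 2)) ≡ 1
      v[b]≡1 = trans (cong v (trans 2+[b∸2]≡b (sym u₀≡b)))
                 (trans (letter-blockStart (over 1) (Δ 1) 1) (trans (cong flip v₀≡b) flip-b))

    no-smaller-lifted : ∀ i t → t < u i → parity i ≡ 0ℙ → parity t ≡ 0ℙ → 1 ≤ blockStart u i + t →
                        ∀ e → runs i t ≈[ e ] u → runs i t e ≡ 1 → u e ≡ b → ⊥
    no-smaller-lifted i t t<ui i-even t-even 1≤p e runs≈u runs-e≡1 ue≡b =
      nss _ (lifted-start≥1 _ 1≤p)
        (lifted<lex i t t<ui i-even (parity-inBlock (over 2) i t i-even t-even) e runs≈u runs-e≡1 ue≡b)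

    Δ²-noSmallerEvenSuffix : ∀ P → 1 ≤ P → parity P ≡ 0ℙ → ¬ (suffix P u <lex u)
    Δ²-noSmallerEvenSuffix P 1≤P even (e , suffix≈u , lt) with letter-< (over 2 (P + e)) (over 2 e) lt
    ... | u'e≡1 , ue≡b =
      no-smaller-lifted P 0 (proj₁ (Δ 1) P) even refl (≤-trans 1≤P (≤-trans (n≤blockStart (proj₁ (Δ 1)) P) (m≤m+n _ 0)))
        e (λ k k<e → trans (sym (suffix≈runs P k)) (suffix≈u k k<e)) (trans (sym (suffix≈runs P e)) u'e≡1) ue≡b

    -- 1 ◂ suffix (suc i) u is the run-length sequence of v read from the last letter of its i-th run.
    no-smaller-atRunEnd : ∀ i → parity i ≡ 0ℙ → u i ≡ b →
                            ∀ e → (1 ◂ suffix (suc i) u) ≈[ e ] u → (1 ◂ suffix (suc i) u) e ≡ 1 → u e ≡ b → ⊥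
    no-smaller-atRunEnd i even ui≡b e agree e≡1 ue≡b =
      no-smaller-lifted i (suc (b ∸ 2)) (subst (suc (b ∸ 2) <_) (sym ui≡b) b∸1<b) even
        parity-b∸1 (≤-trans (s≤s z≤n) (m≤n+m _ _))
        e (λ k k<e → trans (runs≈ k) (agree k k<e)) (trans (runs≈ e) e≡1) ue≡b
      where
      runs≈ : runs i (suc (b ∸ 2)) ≈w (1 ◂ suffix (suc i) u)
      runs≈ zero = trans (cong (_∸ suc (b ∸ 2)) (trans ui≡b (sym 2+[b∸2]≡b))) (m+n∸n≡m 1 (suc (b ∸ 2)))
      runs≈ (suc k) = refl

    u-after-b11 : ∀ m → parity m ≡ 1ℙ → y m ≡ b → y (suc m) ≡ 1 → y (suc (suc m)) ≡ 1 →
                  ∀ r → r < b → u (blockStart y (suc m) + r) ≡ blockLetter 1 r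
    u-after-b11 m odd ym≡b ym+1≡1 ym+2≡1 r r<b = begin
      u (blockStart y (suc m) + r)   ≡⟨ cong u (sym (blockStart-ones y (suc m) b ones r (<⇒≤ r<b))) ⟩
      u (blockStart y (suc m + r))   ≡⟨ letter-blockStart (over 2) (Δ 2) (suc m + r) ⟩
      blockLetter (u 0) (suc m + r)  ≡⟨ cong (λ a → blockLetter a (suc m + r)) Δ²-head≡1 ⟩
      blockLetter 1 (suc m + r)      ≡⟨ cong (λ p → flipIf p 1) parity≡ ⟩
      blockLetter 1 r                ∎
      where
      open ≡-Reasoning
      ones : ∀ r → r < b → y (suc m + r) ≡ 1
      ones r r<b = trans (longRun (over 3) (over 4) (Δ 3) m (λ eq → 1≢b (trans (sym ym+1≡1) (trans (sym eq) ym≡b)))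
                                  (trans ym+1≡1 (sym ym+2≡1)) r r<b)
                         ym+1≡1
      parity≡ : parity (suc m + r) ≡ parity r
      parity≡ = trans (ℙ.+-homo-+ (suc m) r) (cong (ℙ._+ parity r) (trans (parity-suc m) (cong _⁻¹ odd)))

    -- Assuming y starts with 1, y is forced to alternate from position b on, so z has an infinite run of 1's.
    module _ (y₀≡1 : y 0 ≡ 1) where

      private
        u₀≡1 : u 0 ≡ 1
        u₀≡1 = Δ²-head≡1

      u₁≡b : u 1 ≡ b
      u₁≡b = trans (cong u (sym y₀≡1)) (trans (letter-blockStart (over 2) (Δ 2) 1) (cong flip u₀≡1))

      y-even≡1 : ∀ m → parity m ≡ 0ℙ → y m ≡ 1
      y-even≡1 zero _ = y₀≡1
      y-even≡1 (suc m) even with over 3 (suc m)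
      ... | inj₁ ym≡1 = ym≡1
      ... | inj₂ ym≡b =
        ⊥-elim (Δ²-noSmallerEvenSuffix p 1≤p p-even (1 , agree , subst₂ _<_ (sym (u-block 1 1<b)) (sym u₁≡b) 1<b))
        where
        p : ℕ
        p = blockStart y (suc m)
        1≤p : 1 ≤ p
        1≤p = ≤-trans (s≤s z≤n) (n≤blockStart (proj₁ (Δ 2)) (suc m))
        p-even : parity p ≡ 0ℙ
        p-even = trans (parity-blockStart (over 3) (suc m)) even
        u-block : ∀ r → r < b → u (p + r) ≡ 1
        u-block r r<b = trans (letter-inBlock (over 2) (Δ 2) (suc m) r (subst (r <_) (sym ym≡b) r<b))
                          (trans (cong (λ a → blockLetter a (suc m)) u₀≡1) (blockLetter-even 1 (suc m) even))
        agree : suffix p u ≈[ 1 ] u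
        agree zero _ = trans (u-block 0 (<-trans (s≤s z≤n) 1<b)) (sym u₀≡1)
        agree (suc _) (s≤s ())

      y₁≡1 : y 1 ≡ 1
      y₁≡1 with over 3 1
      ... | inj₁ y₁≡1 = y₁≡1
      ... | inj₂ y₁≡b = ⊥-elim (no-smaller-atRunEnd 2 refl (u-secondBlock 1 1<b) (suc (b ∸ 2)) agree next≡1
                                  (u-secondBlock (b ∸ 2) b∸2<b))
        where
        u-secondBlock : ∀ t → t < b → u (suc t) ≡ b
        u-secondBlock t t<b = trans (cong (λ p → u (p + t)) (sym y₀≡1))
          (trans (letter-inBlock (over 2) (Δ 2) 1 t (subst (t <_) (sym y₁≡b) t<b)) (cong flip u₀≡1))
        agree : (1 ◂ suffix 3 u) ≈[ suc (b ∸ 2) ] u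
        agree zero _ = sym u₀≡1
        agree (suc k) (s≤s k<b-2) =
          trans (u-secondBlock (2 + k) (subst (3 + k ≤_) 2+[b∸2]≡b (+-monoʳ-< 2 k<b-2)))
                (sym (u-secondBlock k (<-trans k<b-2 b∸2<b)))
        next≡1 : u (3 + (b ∸ 2)) ≡ 1
        next≡1 = trans (cong u (trans (cong suc 2+[b∸2]≡b) (cong₂ _+_ (sym y₀≡1) (sym y₁≡b))))
                   (trans (letter-blockStart (over 2) (Δ 2) 2) u₀≡1)

      z₀≡b : z 0 ≡ b
      z₀≡b with over 4 0
      ... | inj₂ z₀≡b = z₀≡b
      ... | inj₁ z₀≡1 = ⊥-elim (proj₂ (proj₂ (Δ 3)) 0 (trans (cong y z₀≡1) (trans y₁≡1 (sym y₀≡1))))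

      y-firstBlock : ∀ k → k < b → y k ≡ 1
      y-firstBlock k k<b = trans (letter-inBlock (over 3) (Δ 3) 0 k (subst (k <_) (sym z₀≡b) k<b)) y₀≡1

      y[b]≡b : y b ≡ b
      y[b]≡b = trans (cong y (sym z₀≡b)) (trans (letter-blockStart (over 3) (Δ 3) 1) (cong flip y₀≡1))

      u-prefix : ∀ k → k ≤ b → u k ≡ blockLetter 1 k
      u-prefix k k≤b = begin
        u k                      ≡⟨ cong u (sym (blockStart-ones y 0 b y-firstBlock k k≤b)) ⟩
        u (blockStart y k)       ≡⟨ letter-blockStart (over 2) (Δ 2) k ⟩
        blockLetter (u 0) k      ≡⟨ cong (λ a → blockLetter a k) u₀≡1 ⟩
        blockLetter 1 k          ∎
        where open ≡-Reasoning

      u[b+1]≡b : u (suc b) ≡ b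
      u[b+1]≡b = begin
        u (suc b)                ≡⟨ cong u (trans (+-comm 1 b) (cong (_+ 1) (sym (blockStart-ones y 0 b y-firstBlock b ≤-refl)))) ⟩
        u (blockStart y b + 1)   ≡⟨ letter-inBlock (over 2) (Δ 2) b 1 (subst (1 <_) (sym y[b]≡b) 1<b) ⟩
        blockLetter (u 0) b      ≡⟨ trans (cong (λ a → blockLetter a b) u₀≡1) (blockLetter-odd 1 b b-odd) ⟩
        b                        ∎
        where open ≡-Reasoning

      -- Read v from the last letter of its j-th run, j the penultimate position of the m-th run of u:
      -- its run lengths follow u up to position b and then drop to 1 where u has b.
      no-b11 : ∀ m → parity m ≡ 1ℙ → y m ≡ b → y (suc m) ≡ 1 → y (suc (suc m)) ≡ 1 → ⊥
      no-b11 m odd ym≡b ym+1≡1 ym+2≡1 =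
        no-smaller-atRunEnd j j-even (u-runM (b ∸ 2) b∸2<b) (suc b) agree u'[b+1]≡1 u[b+1]≡b
        where
        j : ℕ
        j = blockStart y m + (b ∸ 2)
        u-runM : ∀ t → t < b → u (blockStart y m + t) ≡ b
        u-runM t t<b = trans (letter-inBlock (over 2) (Δ 2) m t (subst (t <_) (sym ym≡b) t<b))
                         (trans (cong (λ a → blockLetter a m) u₀≡1) (blockLetter-odd 1 m odd))
        j-even : parity j ≡ 0ℙ
        j-even = trans (ℙ.+-homo-+ (blockStart y m) (b ∸ 2))
                       (cong₂ ℙ._+_ (trans (parity-blockStart (over 3) m) odd) parity-b∸2)
        u-afterM : ∀ r → r < b → u (blockStart y (suc m) + r) ≡ blockLetter 1 r
        u-afterM = u-after-b11 m odd ym≡b ym+1≡1 ym+2≡1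
        after-j : ∀ r → suc j + suc r ≡ blockStart y (suc m) + r
        after-j r = begin
          suc (blockStart y m + (b ∸ 2) + suc r)    ≡⟨ sym (+-suc _ (suc r)) ⟩
          blockStart y m + (b ∸ 2) + suc (suc r)    ≡⟨ +-assoc (blockStart y m) (b ∸ 2) _ ⟩
          blockStart y m + ((b ∸ 2) + suc (suc r))  ≡⟨ cong (blockStart y m +_) (trans (+-suc _ (suc r)) (cong suc (+-suc _ r))) ⟩
          blockStart y m + (2 + (b ∸ 2) + r)        ≡⟨ cong (λ n → blockStart y m + (n + r)) (trans 2+[b∸2]≡b (sym ym≡b)) ⟩
          blockStart y m + (y m + r)                ≡⟨ sym (+-assoc (blockStart y m) (y m) r) ⟩
          blockStart y (suc m) + r                  ∎
          where open ≡-Reasoning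
        agree : (1 ◂ suffix (suc j) u) ≈[ suc b ] u
        agree zero _ = sym u₀≡1
        agree (suc zero) _ = trans (cong u (trans (+-identityʳ (suc j)) (sym (+-suc (blockStart y m) (b ∸ 2)))))
                                   (trans (u-runM (suc (b ∸ 2)) b∸1<b) (sym u₁≡b))
        agree (suc (suc r)) (s≤s r+2≤b) =
          trans (cong u (after-j r)) (trans (u-afterM r (<-trans (n<1+n r) r+2≤b)) (sym (u-prefix (suc (suc r)) r+2≤b)))
        u'[b+1]≡1 : u (suc j + b) ≡ 1
        u'[b+1]≡1 = begin
          u (suc j + b)                        ≡⟨ cong (λ n → u (suc j + n)) (sym 2+[b∸2]≡b) ⟩
          u (suc j + suc (suc (b ∸ 2)))        ≡⟨ cong u (after-j (suc (b ∸ 2))) ⟩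
          u (blockStart y (suc m) + suc (b ∸ 2)) ≡⟨ u-afterM (suc (b ∸ 2)) b∸1<b ⟩
          blockLetter 1 (suc (b ∸ 2))          ≡⟨ blockLetter-even 1 (suc (b ∸ 2)) parity-b∸1 ⟩
          1                                    ∎
          where open ≡-Reasoning

      y-tail : ∀ r → y (b + r) ≡ blockLetter b r
      y-tail r with parity r in r-parity
      ... | 1ℙ = trans (y-even≡1 (b + r) (trans (parity-b+ r) (cong _⁻¹ r-parity)))
                       (sym flip-b)
      y-tail zero | 0ℙ = trans (cong y (+-identityʳ b)) y[b]≡b
      y-tail (suc zero) | 0ℙ = ⊥-elim (ℙ.p≢p⁻¹ 1ℙ r-parity)
      y-tail (suc (suc r)) | 0ℙ with over 3 (b + suc (suc r))
      ... | inj₂ y≡b = y≡b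
      ... | inj₁ y≡1 = ⊥-elim (no-b11 (b + r) m-odd (trans (y-tail r) (blockLetter-even b r r-parity))
                                      (y-even≡1 (suc (b + r)) (trans (parity-suc (b + r)) (cong _⁻¹ m-odd)))
                                      (trans (cong y (sym (trans (+-suc b (suc r)) (cong suc (+-suc b r))))) y≡1))
        where
        m-odd : parity (b + r) ≡ 1ℙ
        m-odd = trans (parity-b+ r) (cong _⁻¹ r-parity)

      y-alternates : ∀ r → y (b + r) ≢ y (b + suc r)
      y-alternates r eq = flip-≢ (blockLetter-letter (inj₂ refl) r)
        (trans (sym (blockLetter-suc (inj₂ refl) r)) (trans (sym (y-tail (suc r))) (trans (sym eq) (y-tail r))))

      z-tail-start : ∀ i → blockStart z (suc i) ≡ b + i
      z-tail : ∀ i → z (suc i) ≡ 1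
      z-tail-start zero = trans z₀≡b (sym (+-identityʳ b))
      z-tail-start (suc i) = trans (cong₂ _+_ (z-tail-start i) (z-tail i)) (trans (+-assoc b i 1) (cong (b +_) (+-comm i 1)))
      z-tail i with over 4 (suc i)
      ... | inj₁ z≡1 = z≡1
      ... | inj₂ z≡b = ⊥-elim (y-alternates i (begin
        y (b + i)                            ≡⟨ cong y (sym (z-tail-start i)) ⟩
        y (blockStart z (suc i))             ≡⟨ sym (proj₁ (proj₂ (Δ 3)) (suc i) 1 (subst (1 <_) (sym z≡b) 1<b)) ⟩
        y (blockStart z (suc i) + 1)         ≡⟨ cong (λ p → y (p + 1)) (z-tail-start i) ⟩
        y (b + i + 1)                        ≡⟨ cong y (trans (+-assoc b i 1) (cong (b +_) (+-comm i 1))) ⟩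
        y (b + suc i)                        ∎))
        where open ≡-Reasoning

      Δ³-head≢1 : ⊥
      Δ³-head≢1 = proj₂ (proj₂ (Δ 4)) 1 (trans (z-pos _ (≤-trans 1≤X₅₀ (blockStart-mono (X 5) (s≤s z≤n))))
                                               (sym (z-pos _ 1≤X₅₀)))
        where
        1≤X₅₀ : 1 ≤ X 5 0
        1≤X₅₀ = proj₁ (Δ 4) 0
        z-pos : ∀ n → 1 ≤ n → z n ≡ 1
        z-pos (suc i) _ = z-tail i

    Δ³-head≡b : y 0 ≡ b
    Δ³-head≡b with over 3 0
    ... | inj₂ y₀≡b = y₀≡b
    ... | inj₁ y₀≡1 = ⊥-elim (Δ³-head≢1 y₀≡1)

    Δ²-noSmallerSuffix : NoSmallerSuffix u
    Δ²-noSmallerSuffix P 1≤P smaller with parity P in P-parity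
    ... | 0ℙ = Δ²-noSmallerEvenSuffix P 1≤P P-parity smaller
    ... | 1ℙ with locate (proj₁ (Δ 2)) P | smallerSuffix-head (over 2) Δ²-head≡1 P smaller
    ...   | j , t , t<yj , refl | uP≡1 with parity j in j-parity
    ...     | 1ℙ = 1≢b (trans (sym uP≡1) (trans (letter-inBlock (over 2) (Δ 2) j t t<yj)
                                           (trans (cong (λ a → blockLetter a j) Δ²-head≡1) (blockLetter-odd 1 j j-parity))))
    ...     | 0ℙ = in-block t t<yj P-parity smaller
      where
      in-block : ∀ t → t < y j → parity (blockStart y j + t) ≡ 1ℙ → ¬ (suffix (blockStart y j + t) u <lex u)
      in-block zero _ odd _ =
        ℙ.p≢p⁻¹ 0ℙ (trans (sym (trans (cong parity (+-identityʳ (blockStart y j)))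
                                      (trans (parity-blockStart (over 3) j) j-parity)))
                           odd)
      in-block (suc t) t+1<yj _ =
        <lex-asym (<lex-suffixInside1Block (over 2) (over 3) (Δ 2) Δ²-head≡1 Δ³-head≡b j t t+1<yj j-parity)

  lyndon-alternatingHeads : ∀ {X} → Tower X → NoSmallerSuffix (X 0) → X 0 0 ≡ 1 → X 1 0 ≡ b → AlternatingHeads X
  lyndon-alternatingHeads T nss w₀≡1 v₀≡b = alternatingHeads Lyndon1b step T (nss , w₀≡1 , v₀≡b)
    where
    Lyndon1b : (ℕ → Word) → Set
    Lyndon1b X = NoSmallerSuffix (X 0) × X 0 0 ≡ 1 × X 1 0 ≡ b
    step : ∀ {X} → Tower X → Lyndon1b X → X 0 0 ≡ 1 × X 1 0 ≡ b × Lyndon1b (shift (shift X))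
    step T (nss , w₀≡1 , v₀≡b) = w₀≡1 , v₀≡b , Δ²-noSmallerSuffix , Δ²-head≡1 , Δ³-head≡b
      where open LyndonLevels T nss w₀≡1 v₀≡b

proposition26 : (b : ℕ) → 1 < b → ¬ (2 ∣ b) →
    (m : Word) → IsMinSmooth b m →
    (InfLyndon m × ((s : Smooth b m) → (Φ s 0 ≡ 1) × (Φ s 1 ≡ b)))
    × ((w : Word) → (s : Smooth b w) → InfLyndon w → Φ s 0 ≡ 1 → Φ s 1 ≡ b → w ≈w m)
proposition26 b 1<b 2∤b m ((M , M₀≈m , TM) , min) = (lyndon , Φ-prefix) , unique
  where
  open OddAlphabet b 1<b (¬2∣⇒parity≡1ℙ b 2∤b)
  minimal-M₀ : Minimal (M 0)
  minimal-M₀ = minimal-resp-≈ (λ n → sym (M₀≈m n)) min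
  lyndon : InfLyndon m
  lyndon k 1≤k = <lex-resp-≈ M₀≈m (λ i → M₀≈m (k + i)) (minimal⇒lyndon k TM minimal-M₀ 1≤k)
  Φ-prefix : (s : Smooth b m) → Φ s 0 ≡ 1 × Φ s 1 ≡ b
  Φ-prefix (W , W₀≈m , TW) = minimal-head≡1 TW minimal-W₀ , minimal-Δhead≡b TW minimal-W₀
    where
    minimal-W₀ : Minimal (W 0)
    minimal-W₀ = minimal-resp-≈ (λ n → sym (W₀≈m n)) min
  unique : (w : Word) → (s : Smooth b w) → InfLyndon w → Φ s 0 ≡ 1 → Φ s 1 ≡ b → w ≈w m
  unique w (W , W₀≈w , TW) lyndon-w Φ₀≡1 Φ₁≡b n = begin
    w n       ≡⟨ sym (W₀≈w n) ⟩
    W 0 n     ≡⟨ alternatingHeads-determine TW TM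
                   (lyndon-alternatingHeads TW (lyndon⇒noSmallerSuffix W₀≈w lyndon-w) Φ₀≡1 Φ₁≡b)
                   (minimal-alternatingHeads TM minimal-M₀) n ⟩
    M 0 n     ≡⟨ M₀≈m n ⟩
    m n       ∎
    where open ≡-Reasoning
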